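{- Fix integers $t\ge1$ and $\Delta\ge1$. There are constants $c_1,c_2>0$ depending only on $t$ and $\Delta$ such that the following holds. Let $G$ be a graph of treewidth at most $t$ and maximum degree at most $\Delta$, and let $X\subseteq V(G)$ be a balanced separator with $|X|\le t+1$. Partition the independent sets of $G$ into classes, two independent sets $S,S'$ being in the same class iff $S\cap X=S'\cap X$; write $\mathcal{C}_T$ for the class of independent sets $S$ with $S\cap X=T$. Then: (1) the number of classes is at most $2^{t+1}$; (2) for any two classes, $|\mathcal{C}_T|\le c_1|\mathcal{C}_{T'}|$; (3) for distinct classes $\mathcal{C}_T,\mathcal{C}_{T'}$, no independent set in $\mathcal{C}_T$ is adjacent in $\mathcal{M}_{IS}(G)$ to more than one independent set in $\mathcal{C}_{T'}$; (4) if there is at least one edge of $\mathcal{M}_{IS}(G)$ between $\mathcal{C}_T$ and $\mathcal{C}_{T'}$, then there are at least $c_2|\mathcal{C}_T|$ such edges.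
   Context: $\mathcal{M}_{IS}(G)$ is the independent set Glauber graph: vertices are independent sets of $G$, adjacent iff their symmetric difference has exactly one vertex. A vertex set $X\subseteq V$ is a balanced separator if deleting $X$ partitions $V\setminus X$ into sets $A,B$ with no edges between them and $|V|/3\le|A|\le|B|\le 2|V|/3$. -}

module Defs where

open import Data.Nat using (ℕ; zero; suc; _+_; _*_; _≤_; _<_)
open import Data.Bool using (Bool; true; false; not; _∧_; _xor_; T)
open import Data.Bool.Properties using () renaming (_≟_ to _≟ᵇ_)
open import Data.Fin using (Fin; zero; suc; toℕ)
open import Data.Fin.Subset using (Subset; _∈_; _∉_; _∩_; _⊆_; ∣_∣)
open import Data.Vec using (Vec; []; _∷_; lookup; tabulate; zipWith)
open import Data.Vec.Properties using (≡-dec)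
open import Data.List using (List; []; _∷_; _++_; map; filter; length; allFin; cartesianProduct)
open import Data.Product using (Σ; _×_; _,_; ∃; proj₁; proj₂)
open import Data.Sum using (_⊎_)
open import Relation.Binary.PropositionalEquality using (_≡_)
open import Relation.Nullary using (¬_)
open import Relation.Nullary.Decidable using (T?)
open import Data.Nat using (_<?_)

record Graph (n : ℕ) : Set where
  field
    adj     : Fin n → Fin n → Bool
    symm    : ∀ u v → adj u v ≡ adj v u
    irrefl  : ∀ v → adj v v ≡ false
open Graph public

nbhd : ∀ {n} → Graph n → Fin n → Subset n
nbhd G v = tabulate (adj G v)

degree : ∀ {n} → Graph n → Fin n → ℕ
degree G v = ∣ nbhd G v ∣

MaxDegreeAtMost : ∀ {n} → Graph n → ℕ → Set
MaxDegreeAtMost G Δ = ∀ v → degree G v ≤ Δ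

-- Trees and tree decompositions.
-- A tree on nodes Fin (suc m): node (suc i) has parent `parent i`, whose
-- index is at most i (every finite tree admits such a labelling, e.g. BFS order).

record Tree (m : ℕ) : Set where
  field
    parent     : Fin m → Fin (suc m)
    parent-lt  : ∀ i → toℕ (parent i) ≤ toℕ i
open Tree public

TreeAdj : ∀ {m} → Tree m → Fin (suc m) → Fin (suc m) → Set
TreeAdj Tr a b =
  (Σ _ λ i → (a ≡ suc i) × (b ≡ parent Tr i)) ⊎
  (Σ _ λ i → (b ≡ suc i) × (a ≡ parent Tr i))

data Walk {k : ℕ} (E : Fin k → Fin k → Set) (P : Fin k → Set) : Fin k → Fin k → Set where
  here : ∀ {a} → P a → Walk E P a a
  step : ∀ {a b c} → P a → E a b → Walk E P b c → Walk E P a c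

record TreeDecomposition {n : ℕ} (G : Graph n) : Set where
  field
    m          : ℕ
    tree       : Tree m
    bag        : Fin (suc m) → Subset n
    covers-vertices : ∀ v → Σ (Fin (suc m)) λ a → v ∈ bag a
    covers-edges    : ∀ u v → adj G u v ≡ true →
                      Σ (Fin (suc m)) λ a → (u ∈ bag a) × (v ∈ bag a)
    connected-occ   : ∀ v a b → v ∈ bag a → v ∈ bag b →
                      Walk (TreeAdj tree) (λ c → v ∈ bag c) a b
open TreeDecomposition public

TreewidthAtMost : ∀ {n} → Graph n → ℕ → Set
TreewidthAtMost G t = Σ (TreeDecomposition G) λ D → ∀ a → ∣ bag D a ∣ ≤ suc t

IsBalancedSeparator : ∀ {n} → Graph n → Subset n → Set
IsBalancedSeparator {n} G X =
  Σ (Subset n) λ A → Σ (Subset n) λ B →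
    (∀ v → (v ∈ X) ⊎ ((v ∈ A) ⊎ (v ∈ B))) ×
    (∀ v → v ∈ X → v ∉ A) × (∀ v → v ∈ X → v ∉ B) × (∀ v → v ∈ A → v ∉ B) ×
    (∀ u v → u ∈ A → v ∈ B → adj G u v ≡ false) ×
    (n ≤ 3 * ∣ A ∣) × (∣ A ∣ ≤ ∣ B ∣) × (3 * ∣ B ∣ ≤ 2 * n)

allᵇ : ∀ {A : Set} → (A → Bool) → List A → Bool
allᵇ p [] = true
allᵇ p (x ∷ xs) = p x ∧ allᵇ p xs

indepᵇ : ∀ {n} → Graph n → Subset n → Bool
indepᵇ {n} G S =
  allᵇ (λ u → allᵇ (λ v → not (lookup S u ∧ lookup S v ∧ adj G u v)) (allFin n)) (allFin n)

Independent : ∀ {n} → Graph n → Subset n → Set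
Independent G S = T (indepᵇ G S)

allSubsets : ∀ n → List (Subset n)
allSubsets zero = [] ∷ []
allSubsets (suc n) = map (true ∷_) (allSubsets n) ++ map (false ∷_) (allSubsets n)

indepSets : ∀ {n} → Graph n → List (Subset n)
indepSets G = filter (λ S → T? (indepᵇ G S)) (allSubsets _)

_≟S_ : ∀ {n} (S S′ : Subset n) → Relation.Nullary.Dec (S ≡ S′)
_≟S_ = ≡-dec _≟ᵇ_

classList : ∀ {n} → Graph n → Subset n → Subset n → List (Subset n)
classList G X T′ = filter (λ S → (S ∩ X) ≟S T′) (indepSets G)

classSize : ∀ {n} → Graph n → Subset n → Subset n → ℕ
classSize G X T′ = length (classList G X T′)

numClasses : ∀ {n} → Graph n → Subset n → ℕ
numClasses G X = length (filter (λ T′ → 0 <? classSize G X T′) (allSubsets _))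

symDiff : ∀ {n} → Subset n → Subset n → Subset n
symDiff = zipWith _xor_

GlauberAdj : ∀ {n} → Subset n → Subset n → Set
GlauberAdj S S′ = ∣ symDiff S S′ ∣ ≡ 1

GlauberAdj? : ∀ {n} (S S′ : Subset n) → Relation.Nullary.Dec (GlauberAdj S S′)
GlauberAdj? S S′ = ∣ symDiff S S′ ∣ Data.Nat.≟ 1

edgesBetween : ∀ {n} → Graph n → Subset n → Subset n → Subset n → ℕ
edgesBetween G X T₁ T₂ =
  length (filter (λ p → GlauberAdj? (proj₁ p) (proj₂ p))
                 (cartesianProduct (classList G X T₁) (classList G X T₂)))

-- All counting goes through `override zs T S`, which agrees with T on the vertex list zs and with S
-- elsewhere.  If zs contains every neighbour of the T-vertices in zs, overriding preserves
-- independence, and S is determined by its override together with its bits on zs, so a map from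
-- which the override can be read off is at most 2 ^ length zs to one.
-- (1) A class C_T is determined by T ⊆ X.
-- (2) Overriding by T₂ on X ∪ N(T₂) maps C_T₁ into C_T₂, and ∣ X ∪ N(T₂) ∣ ≤ (1 + Δ) ∣ X ∣.
-- (3) A Glauber step between different classes toggles a single vertex v, which must lie in X, so
--     the two traces differ exactly at v; this determines the neighbour.
-- (4) Then neither trace meets N(v), and overriding S ∈ C_T₁ on N[v] by T₁ and by T₂ yields two
--     sets differing only at v, i.e. an edge between the classes.

{-# OPTIONS --safe #-}
module Submission where

open import Defs
open import Data.Bool using (Bool; true; false; not; _∧_; _xor_; T; if_then_else_)
open import Data.Bool.Properties
  using (∧-zeroʳ; ∧-conicalˡ; ∧-distribʳ-xor; xor-same; xor-identityʳ; xor-comm; true-xor; not-involutive;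
         not-¬; ¬-not; T-∧)
open import Data.Empty using (⊥-elim)
open import Data.Unit using (tt)
open import Function using (_∘_; id)
open import Function.Bundles using (Equivalence)
open import Data.Fin using (Fin; zero; suc; _≟_)
open import Data.Fin.Properties using (injective⇒≤)
open import Data.Fin.Subset using (Subset; _∩_; ⁅_⁆; ∣_∣) renaming (⊥ to ∅)
open import Data.Fin.Subset.Properties using (∣⁅x⁆∣≡1; ∩-zeroˡ; ∩-assoc; ∩-idem; p∩q⊆q; p⊆q⇒∣p∣≤∣q∣)
open import Data.List using (List; []; _∷_; _++_; map; filter; length; allFin; cartesianProduct; concatMap)
import Data.List as List
open import Data.List.Properties using (length-map; length-++)
open import Data.List.Membership.Propositional using (_∈_; _∉_; lose)
open import Data.List.Membership.Propositional.Properties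
  using (∈-lookup; ∈-map⁺; ∈-map⁻; ∈-++⁺ˡ; ∈-++⁺ʳ; ∈-filter⁺; ∈-filter⁻; ∈-allFin;
         ∈-cartesianProduct⁺; ∈-cartesianProduct⁻; ∈-concatMap⁺)
open import Data.List.Relation.Unary.Any using (here; there; index; any?)
open import Data.List.Relation.Unary.Any.Properties using (lookup-index)
open import Data.List.Relation.Unary.All as All using ()
open import Data.List.Relation.Unary.AllPairs using ([]; _∷_)
open import Data.List.Relation.Unary.Unique.Propositional using (Unique)
import Data.List.Relation.Unary.Unique.Propositional.Properties as Unique
open import Data.Nat using (ℕ; zero; suc; _+_; _*_; _^_; _≤_; _<_; z≤n; s≤s; _<?_)
open import Data.Nat.Properties
  using (suc-injective; ≤-trans; ≤-reflexive; +-mono-≤; +-monoʳ-≤; *-monoʳ-≤; *-monoˡ-≤; ^-monoʳ-≤;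
         *-comm; *-suc; +-identityʳ; m^n>0; module ≤-Reasoning)
open import Data.Product using (Σ; ∃; _×_; _,_; proj₁; proj₂)
open import Data.Sum as Sum using (_⊎_; inj₁; inj₂; [_,_]′)
open import Data.Vec using (Vec; []; _∷_; lookup; tabulate)
open import Data.Vec.Properties
  using (lookup∘tabulate; tabulate∘lookup; tabulate-cong; lookup-zipWith; lookup-replicate; zipWith-comm)
open import Relation.Binary.PropositionalEquality
open import Relation.Nullary using (¬_; yes; no; does)
open import Relation.Nullary.Decidable using (dec-true; dec-false)

private
  variable
    A B : Set
    n : ℕ

lookup-injective : {xs : List A} → Unique xs → ∀ i j → List.lookup xs i ≡ List.lookup xs j → i ≡ j
lookup-injective (_ ∷ _) zero zero _ = refl
lookup-injective (x∉ ∷ _) zero (suc j) eq = ⊥-elim (All.lookup x∉ (∈-lookup j) eq)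
lookup-injective (x∉ ∷ _) (suc i) zero eq = ⊥-elim (All.lookup x∉ (∈-lookup i) (sym eq))
lookup-injective (_ ∷ u) (suc i) (suc j) eq = cong suc (lookup-injective u i j eq)

length≤-by-injection : {xs : List A} {ys : List B} (f : A → B) → Unique xs →
  (∀ {x} → x ∈ xs → f x ∈ ys) →
  (∀ {x y} → x ∈ xs → y ∈ xs → f x ≡ f y → x ≡ y) →
  length xs ≤ length ys
length≤-by-injection {xs = xs} {ys} f xs! f∈ys f-inj = injective⇒≤ {f = g} g-injective
  where
  g : Fin (length xs) → Fin (length ys)
  g i = index (f∈ys (∈-lookup i))
  g-injective : ∀ {i j} → g i ≡ g j → i ≡ j
  g-injective {i} {j} eq = lookup-injective xs! i j (f-inj (∈-lookup i) (∈-lookup j) (begin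
    f (List.lookup xs i)            ≡⟨ lookup-index (f∈ys (∈-lookup i)) ⟩
    List.lookup ys (g i)            ≡⟨ cong (List.lookup ys) eq ⟩
    List.lookup ys (g j)            ≡⟨ lookup-index (f∈ys (∈-lookup j)) ⟨
    f (List.lookup xs j)            ∎))
    where open ≡-Reasoning

length-cartesianProduct : (xs : List A) (ys : List B) →
  length (cartesianProduct xs ys) ≡ length xs * length ys
length-cartesianProduct [] ys = refl
length-cartesianProduct (x ∷ xs) ys =
  trans (length-++ (map (x ,_) ys)) (cong₂ _+_ (length-map (x ,_) ys) (length-cartesianProduct xs ys))

length-concatMap≤ : (f : A → List B) {k : ℕ} (xs : List A) → (∀ x → length (f x) ≤ k) →
  length (concatMap f xs) ≤ k * length xs
length-concatMap≤ f {k} [] _ = z≤n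
length-concatMap≤ f {k} (x ∷ xs) f≤k = begin
  length (f x ++ concatMap f xs)           ≡⟨ length-++ (f x) ⟩
  length (f x) + length (concatMap f xs)   ≤⟨ +-mono-≤ (f≤k x) (length-concatMap≤ f xs f≤k) ⟩
  k + k * length xs                        ≡⟨ *-suc k (length xs) ⟨
  k * suc (length xs)                      ∎
  where open ≤-Reasoning

nonempty⇒∈ : {xs : List A} → 0 < length xs → ∃ λ x → x ∈ xs
nonempty⇒∈ {xs = x ∷ _} _ = x , here refl

lookup-extensional : {p q : Vec A n} → (∀ u → lookup p u ≡ lookup q u) → p ≡ q
lookup-extensional {p = p} {q} p≗q =
  trans (sym (tabulate∘lookup p)) (trans (tabulate-cong p≗q) (tabulate∘lookup q))

allSubsets-complete : (S : Subset n) → S ∈ allSubsets n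
allSubsets-complete [] = here refl
allSubsets-complete {suc n} (true ∷ S) = ∈-++⁺ˡ (∈-map⁺ (true ∷_) (allSubsets-complete S))
allSubsets-complete {suc n} (false ∷ S) =
  ∈-++⁺ʳ (map (true ∷_) (allSubsets n)) (∈-map⁺ (false ∷_) (allSubsets-complete S))

allSubsets-unique : ∀ n → Unique (allSubsets n)
allSubsets-unique zero = All.[] ∷ []
allSubsets-unique (suc n) =
  Unique.++⁺ (Unique.map⁺ ∷-injectiveʳ (allSubsets-unique n)) (Unique.map⁺ ∷-injectiveʳ (allSubsets-unique n))
    disjoint
  where
  ∷-injectiveʳ : {b : Bool} {S S′ : Subset n} → b ∷ S ≡ b ∷ S′ → S ≡ S′
  ∷-injectiveʳ refl = refl
  disjoint : ∀ {S} → ¬ (S ∈ map (true ∷_) (allSubsets n) × S ∈ map (false ∷_) (allSubsets n))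
  disjoint (S∈ , S∈′) with ∈-map⁻ (true ∷_) S∈ | ∈-map⁻ (false ∷_) S∈′
  ... | _ , _ , refl | _ , _ , ()

length-allSubsets : ∀ n → length (allSubsets n) ≡ 2 ^ n
length-allSubsets zero = refl
length-allSubsets (suc n) = begin
  length (map (true ∷_) (allSubsets n) ++ map (false ∷_) (allSubsets n))
    ≡⟨ length-++ (map (true ∷_) (allSubsets n)) ⟩
  length (map (true ∷_) (allSubsets n)) + length (map (false ∷_) (allSubsets n))
    ≡⟨ cong₂ _+_ (length-map _ (allSubsets n)) (length-map _ (allSubsets n)) ⟩
  length (allSubsets n) + length (allSubsets n)
    ≡⟨ cong (λ k → k + k) (length-allSubsets n) ⟩
  2 ^ n + 2 ^ n                                  ≡⟨ cong (2 ^ n +_) (+-identityʳ (2 ^ n)) ⟨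
  2 ^ n + (2 ^ n + 0)                            ∎
  where open ≡-Reasoning

members : Subset n → List (Fin n)
members [] = []
members (true ∷ S) = zero ∷ map suc (members S)
members (false ∷ S) = map suc (members S)

length-members : (S : Subset n) → length (members S) ≡ ∣ S ∣
length-members [] = refl
length-members (true ∷ S) = cong suc (trans (length-map suc (members S)) (length-members S))
length-members (false ∷ S) = trans (length-map suc (members S)) (length-members S)

∈-members : (S : Subset n) {u : Fin n} → lookup S u ≡ true → u ∈ members S
∈-members (true ∷ S) {zero} _ = here refl
∈-members (true ∷ S) {suc u} Su = there (∈-map⁺ suc (∈-members S Su))
∈-members (false ∷ S) {suc u} Su = ∈-map⁺ suc (∈-members S Su)

restrict : (zs : List (Fin n)) → Subset n → Subset (length zs)
restrict zs S = tabulate (λ i → lookup S (List.lookup zs i))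

restrict-injective : (zs : List (Fin n)) {S S′ : Subset n} → restrict zs S ≡ restrict zs S′ →
  ∀ {u} → u ∈ zs → lookup S u ≡ lookup S′ u
restrict-injective zs {S} {S′} eq {u} u∈zs = begin
  lookup S u                        ≡⟨ cong (lookup S) (lookup-index u∈zs) ⟩
  lookup S (List.lookup zs i)       ≡⟨ lookup∘tabulate _ i ⟨
  lookup (restrict zs S) i          ≡⟨ cong (λ R → lookup R i) eq ⟩
  lookup (restrict zs S′) i         ≡⟨ lookup∘tabulate _ i ⟩
  lookup S′ (List.lookup zs i)      ≡⟨ cong (lookup S′) (lookup-index u∈zs) ⟨
  lookup S′ u                       ∎
  where
  open ≡-Reasoning
  i : Fin (length zs)
  i = index u∈zs

∈-members⁻ : (S : Subset n) {u : Fin n} → u ∈ members S → lookup S u ≡ true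
∈-members⁻ (true ∷ S) {zero} _ = refl
∈-members⁻ (true ∷ S) {suc u} (there u∈) with ∈-map⁻ suc u∈
... | w , w∈ , refl = ∈-members⁻ S w∈
∈-members⁻ (false ∷ S) {u} u∈ with ∈-map⁻ suc u∈
... | w , w∈ , refl = ∈-members⁻ S w∈

∉-members : (S : Subset n) {u : Fin n} → u ∉ members S → lookup S u ≡ false
∉-members S {u} u∉ = ¬-not (λ Su → u∉ (∈-members S Su))

lookup-∩ : (p q : Subset n) (u : Fin n) → lookup (p ∩ q) u ≡ (lookup p u ∧ lookup q u)
lookup-∩ p q u = lookup-zipWith _∧_ u p q

∩-outside : (S X : Subset n) {u : Fin n} → lookup X u ≡ false → lookup (S ∩ X) u ≡ false
∩-outside S X {u} Xu = trans (lookup-∩ S X u) (trans (cong (lookup S u ∧_) Xu) (∧-zeroʳ (lookup S u)))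

∩-idempotentʳ : (S X : Subset n) → (S ∩ X) ∩ X ≡ S ∩ X
∩-idempotentʳ S X = trans (∩-assoc S X X) (cong (S ∩_) (∩-idem X))

∩-cong-members : (X : Subset n) {T T′ : Subset n} → (∀ {u} → u ∈ members X → lookup T u ≡ lookup T′ u) →
  T ∩ X ≡ T′ ∩ X
∩-cong-members X {T} {T′} agree =
  lookup-extensional λ u → trans (lookup-∩ T X u) (trans (∧-agree u) (sym (lookup-∩ T′ X u)))
  where
  ∧-agree : ∀ u → (lookup T u ∧ lookup X u) ≡ (lookup T′ u ∧ lookup X u)
  ∧-agree u with lookup X u in Xu
  ... | true = cong (_∧ true) (agree (∈-members X Xu))
  ... | false = trans (∧-zeroʳ (lookup T u)) (sym (∧-zeroʳ (lookup T′ u)))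

lookup-symDiff : (p q : Subset n) (u : Fin n) → lookup (symDiff p q) u ≡ (lookup p u xor lookup q u)
lookup-symDiff p q u = lookup-zipWith _xor_ u p q

symDiff-comm : (p q : Subset n) → symDiff p q ≡ symDiff q p
symDiff-comm = zipWith-comm xor-comm

symDiff-identityʳ : (p : Subset n) → symDiff p ∅ ≡ p
symDiff-identityʳ [] = refl
symDiff-identityʳ (x ∷ p) = cong₂ _∷_ (xor-identityʳ x) (symDiff-identityʳ p)

symDiff-involutive : (p q : Subset n) → symDiff p (symDiff p q) ≡ q
symDiff-involutive [] [] = refl
symDiff-involutive (x ∷ p) (y ∷ q) = cong₂ _∷_ (xor-involutive x y) (symDiff-involutive p q)
  where
  xor-involutive : ∀ x y → (x xor (x xor y)) ≡ y
  xor-involutive false y = refl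
  xor-involutive true y = not-involutive y

symDiff-cancelˡ : (p : Subset n) {q r : Subset n} → symDiff p q ≡ symDiff p r → q ≡ r
symDiff-cancelˡ p {q} {r} eq =
  trans (sym (symDiff-involutive p q)) (trans (cong (symDiff p) eq) (symDiff-involutive p r))

symDiff≡∅⇒≡ : {p q : Subset n} → symDiff p q ≡ ∅ → p ≡ q
symDiff≡∅⇒≡ {p = p} {q} eq =
  sym (trans (sym (symDiff-involutive p q)) (trans (cong (symDiff p) eq) (symDiff-identityʳ p)))

∩-distribʳ-symDiff : (p q r : Subset n) → symDiff p q ∩ r ≡ symDiff (p ∩ r) (q ∩ r)
∩-distribʳ-symDiff [] [] [] = refl
∩-distribʳ-symDiff (x ∷ p) (y ∷ q) (z ∷ r) = cong₂ _∷_ (∧-distribʳ-xor z x y) (∩-distribʳ-symDiff p q r)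

∣p∣≡0⇒p≡∅ : (p : Subset n) → ∣ p ∣ ≡ 0 → p ≡ ∅
∣p∣≡0⇒p≡∅ [] _ = refl
∣p∣≡0⇒p≡∅ (false ∷ p) eq = cong (false ∷_) (∣p∣≡0⇒p≡∅ p eq)

∣p∣≡1⇒p≡⁅x⁆ : (p : Subset n) → ∣ p ∣ ≡ 1 → ∃ λ x → p ≡ ⁅ x ⁆
∣p∣≡1⇒p≡⁅x⁆ (true ∷ p) eq = zero , cong (true ∷_) (∣p∣≡0⇒p≡∅ p (suc-injective eq))
∣p∣≡1⇒p≡⁅x⁆ (false ∷ p) eq with ∣p∣≡1⇒p≡⁅x⁆ p eq
... | x , refl = suc x , refl

⁅x⁆∩p : (x : Fin n) (p : Subset n) → ⁅ x ⁆ ∩ p ≡ ⁅ x ⁆ ⊎ ⁅ x ⁆ ∩ p ≡ ∅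
⁅x⁆∩p zero (true ∷ p) = inj₁ (cong (true ∷_) (∩-zeroˡ p))
⁅x⁆∩p zero (false ∷ p) = inj₂ (cong (false ∷_) (∩-zeroˡ p))
⁅x⁆∩p (suc x) (_ ∷ p) = Sum.map (cong (false ∷_)) (cong (false ∷_)) (⁅x⁆∩p x p)

lookup-⁅x⁆ : (x u : Fin n) → lookup ⁅ x ⁆ u ≡ does (u ≟ x)
lookup-⁅x⁆ zero zero = refl
lookup-⁅x⁆ zero (suc u) = lookup-replicate u false
lookup-⁅x⁆ (suc x) zero = refl
lookup-⁅x⁆ (suc x) (suc u) = lookup-⁅x⁆ x u

module _ {p q : Subset n} {x : Fin n} (p⊕q≡⁅x⁆ : symDiff p q ≡ ⁅ x ⁆) where

  private
    lookup-flipped : ∀ u → lookup q u ≡ (lookup p u xor does (u ≟ x))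
    lookup-flipped u = begin
      lookup q u                                 ≡⟨ cong (λ r → lookup r u) (symDiff-involutive p q) ⟨
      lookup (symDiff p (symDiff p q)) u         ≡⟨ lookup-symDiff p (symDiff p q) u ⟩
      (lookup p u xor lookup (symDiff p q) u)    ≡⟨ cong (λ r → lookup p u xor lookup r u) p⊕q≡⁅x⁆ ⟩
      (lookup p u xor lookup ⁅ x ⁆ u)            ≡⟨ cong (lookup p u xor_) (lookup-⁅x⁆ x u) ⟩
      (lookup p u xor does (u ≟ x))              ∎
      where open ≡-Reasoning

  flipped-at : lookup q x ≡ not (lookup p x)
  flipped-at = begin
    lookup q x                     ≡⟨ lookup-flipped x ⟩
    (lookup p x xor does (x ≟ x))  ≡⟨ cong (lookup p x xor_) (dec-true (x ≟ x) refl) ⟩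
    (lookup p x xor true)          ≡⟨ xor-comm (lookup p x) true ⟩
    (true xor lookup p x)          ≡⟨ true-xor (lookup p x) ⟩
    not (lookup p x)               ∎
    where open ≡-Reasoning

  flipped-elsewhere : ∀ {u} → u ≢ x → lookup q u ≡ lookup p u
  flipped-elsewhere {u} u≢x =
    trans (lookup-flipped u) (trans (cong (lookup p u xor_) (dec-false (u ≟ x) u≢x))
      (xor-identityʳ (lookup p u)))

override : List (Fin n) → Subset n → Subset n → Subset n
override zs T S = tabulate (λ u → if does (any? (u ≟_) zs) then lookup T u else lookup S u)

module _ (zs : List (Fin n)) (T S : Subset n) {u : Fin n} where

  private
    lookup-override : lookup (override zs T S) u ≡ (if does (any? (u ≟_) zs) then lookup T u else lookup S u)
    lookup-override = lookup∘tabulate _ u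

  override-∈ : u ∈ zs → lookup (override zs T S) u ≡ lookup T u
  override-∈ u∈ =
    trans lookup-override (cong (if_then lookup T u else lookup S u) (dec-true (any? (u ≟_) zs) u∈))

  override-∉ : u ∉ zs → lookup (override zs T S) u ≡ lookup S u
  override-∉ u∉ =
    trans lookup-override (cong (if_then lookup T u else lookup S u) (dec-false (any? (u ≟_) zs) u∉))

override-injective : (zs : List (Fin n)) (T : Subset n) {S S′ : Subset n} →
  override zs T S ≡ override zs T S′ → (∀ {u} → u ∈ zs → lookup S u ≡ lookup S′ u) → S ≡ S′
override-injective zs T {S} {S′} eq agree = lookup-extensional pointwise
  where
  pointwise : ∀ u → lookup S u ≡ lookup S′ u
  pointwise u with any? (u ≟_) zs
  ... | yes u∈ = agree u∈
  ... | no u∉ = begin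
    lookup S u                  ≡⟨ override-∉ zs T S u∉ ⟨
    lookup (override zs T S) u  ≡⟨ cong (λ R → lookup R u) eq ⟩
    lookup (override zs T S′) u ≡⟨ override-∉ zs T S′ u∉ ⟩
    lookup S′ u                 ∎
    where open ≡-Reasoning

length≤-by-override : {B : Set} {n : ℕ} {xs : List (Subset n)} {ys : List B}
  (zs : List (Fin n)) (T : Subset n) (f : Subset n → B) → Unique xs → (∀ {S} → S ∈ xs → f S ∈ ys) →
  (∀ {S S′} → f S ≡ f S′ → override zs T S ≡ override zs T S′) →
  length xs ≤ 2 ^ length zs * length ys
length≤-by-override {B = B} {n = n} {xs = xs} {ys = ys} zs T f xs! f∈ys f≡⇒override≡ = begin
  length xs                                              ≤⟨ length≤-by-injection g xs! g∈ g-injective ⟩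
  length (cartesianProduct ys (allSubsets (length zs)))  ≡⟨ length-cartesianProduct ys _ ⟩
  length ys * length (allSubsets (length zs))            ≡⟨ cong (length ys *_) (length-allSubsets (length zs)) ⟩
  length ys * 2 ^ length zs                              ≡⟨ *-comm (length ys) _ ⟩
  2 ^ length zs * length ys                              ∎
  where
  open ≤-Reasoning
  g : Subset n → B × Subset (length zs)
  g S = f S , restrict zs S
  g∈ : ∀ {S} → S ∈ xs → g S ∈ cartesianProduct ys (allSubsets (length zs))
  g∈ S∈ = ∈-cartesianProduct⁺ (f∈ys S∈) (allSubsets-complete _)
  g-injective : ∀ {S S′} → S ∈ xs → S′ ∈ xs → g S ≡ g S′ → S ≡ S′
  g-injective {S} {S′} _ _ eq =
    override-injective zs T (f≡⇒override≡ (cong proj₁ eq))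
      (restrict-injective zs {S} {S′} (cong proj₂ eq))

allᵇ-sound : (p : A → Bool) (xs : List A) → T (allᵇ p xs) → ∀ {x} → x ∈ xs → T (p x)
allᵇ-sound p (y ∷ _) h (here refl) = proj₁ (Equivalence.to T-∧ h)
allᵇ-sound p (y ∷ xs) h (there x∈) = allᵇ-sound p xs (proj₂ (Equivalence.to T-∧ h)) x∈

allᵇ-complete : (p : A → Bool) (xs : List A) → (∀ {x} → x ∈ xs → T (p x)) → T (allᵇ p xs)
allᵇ-complete p [] _ = tt
allᵇ-complete p (y ∷ xs) h = Equivalence.from T-∧ (h (here refl) , allᵇ-complete p xs (h ∘ there))

IsIndependent : Graph n → Subset n → Set
IsIndependent G S = ∀ u v → lookup S u ≡ true → lookup S v ≡ true → adj G u v ≡ false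

lookup-nbhd : (G : Graph n) (v u : Fin n) → lookup (nbhd G v) u ≡ adj G v u
lookup-nbhd G v = lookup∘tabulate (adj G v)

module _ (G : Graph n) (S : Subset n) where

  Independent⇒IsIndependent : Independent G S → IsIndependent G S
  Independent⇒IsIndependent ind u v =
    T-not-∧∧⁻ (allᵇ-sound _ (allFin n) (allᵇ-sound _ (allFin n) ind (∈-allFin u)) (∈-allFin v))
    where
    T-not-∧∧⁻ : ∀ {a b c} → T (not (a ∧ b ∧ c)) → a ≡ true → b ≡ true → c ≡ false
    T-not-∧∧⁻ {c = false} _ _ _ = refl
    T-not-∧∧⁻ {c = true} () refl refl

  IsIndependent⇒Independent : IsIndependent G S → Independent G S
  IsIndependent⇒Independent ind =
    allᵇ-complete _ (allFin n) λ {u} _ → allᵇ-complete _ (allFin n) λ {v} _ →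
      T-not-∧∧⁺ (lookup S u) (lookup S v) (ind u v)
    where
    T-not-∧∧⁺ : ∀ a b {c} → (a ≡ true → b ≡ true → c ≡ false) → T (not (a ∧ b ∧ c))
    T-not-∧∧⁺ false _ _ = tt
    T-not-∧∧⁺ true false _ = tt
    T-not-∧∧⁺ true true h rewrite h refl refl = tt

  isIndependent-∩ : IsIndependent G S → (X : Subset n) → IsIndependent G (S ∩ X)
  isIndependent-∩ ind X u v Su Sv = ind u v (∩-true u Su) (∩-true v Sv)
    where
    ∩-true : ∀ w → lookup (S ∩ X) w ≡ true → lookup S w ≡ true
    ∩-true w h = ∧-conicalˡ _ _ (trans (sym (lookup-∩ S X w)) h)

  isIndependent-non-neighbour : IsIndependent G S → ∀ {v u} → lookup S v ≡ true → adj G v u ≡ true →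
    lookup S u ≡ false
  isIndependent-non-neighbour ind Sv vu = ¬-not λ Su → not-¬ (ind _ _ Sv Su) vu

module _ (G : Graph n) (X T : Subset n) {S : Subset n} where

  ∈-classList⁺ : Independent G S → S ∩ X ≡ T → S ∈ classList G X T
  ∈-classList⁺ ind eq = ∈-filter⁺ _ (∈-filter⁺ _ (allSubsets-complete S) ind) eq

  ∈-classList⁻ : S ∈ classList G X T → Independent G S × S ∩ X ≡ T
  ∈-classList⁻ S∈ with ∈-filter⁻ _ {xs = indepSets G} S∈
  ... | S∈indep , eq = proj₂ (∈-filter⁻ _ {xs = allSubsets n} S∈indep) , eq

classList-unique : (G : Graph n) (X T : Subset n) → Unique (classList G X T)
classList-unique G X T = Unique.filter⁺ _ (Unique.filter⁺ _ (allSubsets-unique _))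

NeighbourClosed : Graph n → List (Fin n) → Subset n → Set
NeighbourClosed G zs T = ∀ {w u} → w ∈ zs → lookup T w ≡ true → adj G w u ≡ true → u ∈ zs

no-edge-leaves : (G : Graph n) {zs : List (Fin n)} {T : Subset n} → NeighbourClosed G zs T →
  ∀ {w x} → w ∈ zs → lookup T w ≡ true → x ∉ zs → adj G w x ≡ false
no-edge-leaves G closed w∈ Tw x∉ = ¬-not λ wx → x∉ (closed w∈ Tw wx)

module _ (zs : List (Fin n)) (T S : Subset n) where

  private
    inside : ∀ {w} → w ∈ zs → lookup (override zs T S) w ≡ true → lookup T w ≡ true
    inside w∈ = trans (sym (override-∈ zs T S w∈))

    outside : ∀ {w} → w ∉ zs → lookup (override zs T S) w ≡ true → lookup S w ≡ true
    outside w∉ = trans (sym (override-∉ zs T S w∉))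

  override-isIndependent : (G : Graph n) → IsIndependent G T → IsIndependent G S → NeighbourClosed G zs T →
    IsIndependent G (override zs T S)
  override-isIndependent G T-ind S-ind closed u v Ru Rv with any? (u ≟_) zs | any? (v ≟_) zs
  ... | yes u∈ | yes v∈ = T-ind u v (inside u∈ Ru) (inside v∈ Rv)
  ... | yes u∈ | no v∉ = no-edge-leaves G {zs} {T} closed u∈ (inside u∈ Ru) v∉
  ... | no u∉ | yes v∈ = trans (symm G u v) (no-edge-leaves G {zs} {T} closed v∈ (inside v∈ Rv) u∉)
  ... | no u∉ | no v∉ = S-ind u v (outside u∉ Ru) (outside v∉ Rv)

  override-∩ : (X : Subset n) → T ∩ X ≡ T → (∀ {u} → u ∉ zs → lookup (S ∩ X) u ≡ lookup T u) →
    override zs T S ∩ X ≡ T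
  override-∩ X T-trace agree-outside = lookup-extensional pointwise
    where
    pointwise : ∀ u → lookup (override zs T S ∩ X) u ≡ lookup T u
    pointwise u with any? (u ≟_) zs
    ... | yes u∈ = begin
      lookup (override zs T S ∩ X) u          ≡⟨ lookup-∩ (override zs T S) X u ⟩
      (lookup (override zs T S) u ∧ lookup X u) ≡⟨ cong (_∧ lookup X u) (override-∈ zs T S u∈) ⟩
      (lookup T u ∧ lookup X u)               ≡⟨ lookup-∩ T X u ⟨
      lookup (T ∩ X) u                        ≡⟨ cong (λ R → lookup R u) T-trace ⟩
      lookup T u                              ∎
      where open ≡-Reasoning
    ... | no u∉ = begin
      lookup (override zs T S ∩ X) u          ≡⟨ lookup-∩ (override zs T S) X u ⟩
      (lookup (override zs T S) u ∧ lookup X u) ≡⟨ cong (_∧ lookup X u) (override-∉ zs T S u∉) ⟩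
      (lookup S u ∧ lookup X u)               ≡⟨ lookup-∩ S X u ⟨
      lookup (S ∩ X) u                        ≡⟨ agree-outside u∉ ⟩
      lookup T u                              ∎
      where open ≡-Reasoning

symDiff-override : (zs : List (Fin n)) {T T′ : Subset n} (S : Subset n) →
  (∀ {u} → u ∉ zs → lookup T u ≡ lookup T′ u) →
  symDiff (override zs T S) (override zs T′ S) ≡ symDiff T T′
symDiff-override zs {T} {T′} S agree = lookup-extensional pointwise
  where
  pointwise : ∀ u → lookup (symDiff (override zs T S) (override zs T′ S)) u ≡ lookup (symDiff T T′) u
  pointwise u with any? (u ≟_) zs
  ... | yes u∈ = begin
    lookup (symDiff (override zs T S) (override zs T′ S)) u
      ≡⟨ lookup-symDiff (override zs T S) (override zs T′ S) u ⟩
    (lookup (override zs T S) u xor lookup (override zs T′ S) u)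
      ≡⟨ cong₂ _xor_ (override-∈ zs T S u∈) (override-∈ zs T′ S u∈) ⟩
    (lookup T u xor lookup T′ u)                               ≡⟨ lookup-symDiff T T′ u ⟨
    lookup (symDiff T T′) u                                    ∎
    where open ≡-Reasoning
  ... | no u∉ = begin
    lookup (symDiff (override zs T S) (override zs T′ S)) u
      ≡⟨ lookup-symDiff (override zs T S) (override zs T′ S) u ⟩
    (lookup (override zs T S) u xor lookup (override zs T′ S) u)
      ≡⟨ cong₂ _xor_ (override-∉ zs T S u∉) (override-∉ zs T′ S u∉) ⟩
    (lookup S u xor lookup S u)                                ≡⟨ xor-same (lookup S u) ⟩
    false                                                      ≡⟨ xor-same (lookup T u) ⟨
    (lookup T u xor lookup T u)                                ≡⟨ cong (lookup T u xor_) (agree u∉) ⟩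
    (lookup T u xor lookup T′ u)                               ≡⟨ lookup-symDiff T T′ u ⟨
    lookup (symDiff T T′) u                                    ∎
    where open ≡-Reasoning

flip-avoids-neighbours : (G : Graph n) {p q : Subset n} {x u : Fin n} →
  IsIndependent G p → IsIndependent G q → symDiff p q ≡ ⁅ x ⁆ → adj G x u ≡ true → lookup p u ≡ false
flip-avoids-neighbours G {p} {q} {x} {u} p-ind q-ind p⊕q xu with lookup p x in px
... | true = isIndependent-non-neighbour G p p-ind px xu
... | false = trans (sym (flipped-elsewhere p⊕q u≢x))
                    (isIndependent-non-neighbour G q q-ind (trans (flipped-at p⊕q) (cong not px)) xu)
  where
  u≢x : u ≢ x
  u≢x refl = not-¬ (irrefl G u) xu

module _ (G : Graph n) (X S : Subset n) {T : Subset n}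
  (S-ind : Independent G S) (S-trace : S ∩ X ≡ T) where

  trace-∩ : T ∩ X ≡ T
  trace-∩ = trans (cong (_∩ X) (sym S-trace)) (trans (∩-idempotentʳ S X) S-trace)

  trace-isIndependent : IsIndependent G T
  trace-isIndependent =
    subst (IsIndependent G) S-trace (isIndependent-∩ G S (Independent⇒IsIndependent G S S-ind) X)

  ∣trace∣≤∣X∣ : ∣ T ∣ ≤ ∣ X ∣
  ∣trace∣≤∣X∣ = subst (λ R → ∣ R ∣ ≤ ∣ X ∣) S-trace (p⊆q⇒∣p∣≤∣q∣ (p∩q⊆q S X))

classRepresentative : (G : Graph n) (X T : Subset n) → 0 < classSize G X T →
  ∃ λ S → Independent G S × S ∩ X ≡ T
classRepresentative G X T nonempty with nonempty⇒∈ nonempty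
... | S , S∈ = S , ∈-classList⁻ G X T S∈

numClasses≤2^∣X∣ : (G : Graph n) (X : Subset n) → numClasses G X ≤ 2 ^ ∣ X ∣
numClasses≤2^∣X∣ {n} G X = begin
  numClasses G X                             ≤⟨ length≤-by-injection (restrict (members X)) classes-unique
                                                  (λ _ → allSubsets-complete _) restrict-injective-on-classes ⟩
  length (allSubsets (length (members X)))   ≡⟨ length-allSubsets (length (members X)) ⟩
  2 ^ length (members X)                     ≡⟨ cong (2 ^_) (length-members X) ⟩
  2 ^ ∣ X ∣                                  ∎
  where
  open ≤-Reasoning
  classes : List (Subset n)
  classes = filter (λ T → 0 <? classSize G X T) (allSubsets n)
  classes-unique : Unique classes
  classes-unique = Unique.filter⁺ _ (allSubsets-unique n)
  class-trace : ∀ {T} → T ∈ classes → T ∩ X ≡ T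
  class-trace {T} T∈ with classRepresentative G X T (proj₂ (∈-filter⁻ _ {xs = allSubsets n} T∈))
  ... | S , S-ind , S-trace = trace-∩ G X S S-ind S-trace
  restrict-injective-on-classes : ∀ {T T′} → T ∈ classes → T′ ∈ classes →
    restrict (members X) T ≡ restrict (members X) T′ → T ≡ T′
  restrict-injective-on-classes {T} {T′} T∈ T′∈ eq =
    trans (sym (class-trace T∈))
      (trans (∩-cong-members X (restrict-injective (members X) {T} {T′} eq)) (class-trace T′∈))

module CompareClasses (G : Graph n) {Δ : ℕ} (maxDeg : MaxDegreeAtMost G Δ) (X S₂ : Subset n) {T₂ : Subset n}
  (S₂-ind : Independent G S₂) (S₂-trace : S₂ ∩ X ≡ T₂) where

  zone : List (Fin n)
  zone = members X ++ concatMap (members ∘ nbhd G) (members T₂)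

  length-zone : length zone ≤ ∣ X ∣ + Δ * ∣ X ∣
  length-zone = begin
    length zone
      ≡⟨ length-++ (members X) ⟩
    length (members X) + length (concatMap (members ∘ nbhd G) (members T₂))
      ≤⟨ +-mono-≤ (≤-reflexive (length-members X))
                  (length-concatMap≤ (members ∘ nbhd G) (members T₂) degree-bound) ⟩
    ∣ X ∣ + Δ * length (members T₂)
      ≡⟨ cong (λ k → ∣ X ∣ + Δ * k) (length-members T₂) ⟩
    ∣ X ∣ + Δ * ∣ T₂ ∣
      ≤⟨ +-monoʳ-≤ ∣ X ∣ (*-monoʳ-≤ Δ (∣trace∣≤∣X∣ G X S₂ S₂-ind S₂-trace)) ⟩
    ∣ X ∣ + Δ * ∣ X ∣
      ∎
    where
    open ≤-Reasoning
    degree-bound : ∀ w → length (members (nbhd G w)) ≤ Δ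
    degree-bound w = ≤-trans (≤-reflexive (length-members (nbhd G w))) (maxDeg w)

  zone-closed : NeighbourClosed G zone T₂
  zone-closed {w} {u} _ T₂w wu = ∈-++⁺ʳ (members X) (∈-concatMap⁺ (members ∘ nbhd G)
    (lose (∈-members T₂ T₂w) (∈-members (nbhd G w) (trans (lookup-nbhd G w u) wu))))

  override-zone-∈ : ∀ {T₁ S} → S ∈ classList G X T₁ → override zone T₂ S ∈ classList G X T₂
  override-zone-∈ {T₁} {S} S∈ =
    ∈-classList⁺ G X T₂ (IsIndependent⇒Independent G (override zone T₂ S) R-ind) R-trace
    where
    R-ind : IsIndependent G (override zone T₂ S)
    R-ind = override-isIndependent zone T₂ S G (trace-isIndependent G X S₂ S₂-ind S₂-trace)
      (Independent⇒IsIndependent G S (proj₁ (∈-classList⁻ G X T₁ S∈))) zone-closed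
    X-outside : ∀ {u} → u ∉ zone → lookup X u ≡ false
    X-outside u∉ = ∉-members X (u∉ ∘ ∈-++⁺ˡ)
    R-trace : override zone T₂ S ∩ X ≡ T₂
    R-trace = override-∩ zone T₂ S X (trace-∩ G X S₂ S₂-ind S₂-trace) λ {u} u∉ → begin
      lookup (S ∩ X) u    ≡⟨ ∩-outside S X (X-outside u∉) ⟩
      false               ≡⟨ ∩-outside T₂ X (X-outside u∉) ⟨
      lookup (T₂ ∩ X) u   ≡⟨ cong (λ R → lookup R u) (trace-∩ G X S₂ S₂-ind S₂-trace) ⟩
      lookup T₂ u         ∎
      where open ≡-Reasoning

classSize≤classSize : (G : Graph n) {Δ : ℕ} → MaxDegreeAtMost G Δ → (X T₁ T₂ : Subset n) →
  0 < classSize G X T₂ → classSize G X T₁ ≤ 2 ^ (∣ X ∣ + Δ * ∣ X ∣) * classSize G X T₂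
classSize≤classSize G maxDeg X T₁ T₂ nonempty with classRepresentative G X T₂ nonempty
... | S₂ , S₂-ind , S₂-trace =
  ≤-trans (length≤-by-override zone T₂ (override zone T₂) (classList-unique G X T₁) override-zone-∈ id)
          (*-monoˡ-≤ (classSize G X T₂) (^-monoʳ-≤ 2 length-zone))
  where open CompareClasses G maxDeg X S₂ S₂-ind S₂-trace

trace-flip : (X : Subset n) {S S′ T T′ : Subset n} {x : Fin n} → S ∩ X ≡ T → S′ ∩ X ≡ T′ → T ≢ T′ →
  symDiff S S′ ≡ ⁅ x ⁆ → symDiff T T′ ≡ ⁅ x ⁆
trace-flip X {S} {S′} {x = x} refl refl T≢T′ S⊕S′ =
  [ trans visible , (λ x∉X → ⊥-elim (T≢T′ (symDiff≡∅⇒≡ (trans visible x∉X)))) ]′ (⁅x⁆∩p x X)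
  where
  visible : symDiff (S ∩ X) (S′ ∩ X) ≡ ⁅ x ⁆ ∩ X
  visible = trans (sym (∩-distribʳ-symDiff S S′ X)) (cong (_∩ X) S⊕S′)

glauber-neighbour-unique : (X : Subset n) {T₁ T₂ S S₁ S₂ : Subset n} → T₁ ≢ T₂ →
  S ∩ X ≡ T₁ → S₁ ∩ X ≡ T₂ → S₂ ∩ X ≡ T₂ → GlauberAdj S S₁ → GlauberAdj S S₂ → S₁ ≡ S₂
glauber-neighbour-unique X {T₁} {T₂} {S} {S₁} {S₂} T₁≢T₂ S-trace S₁-trace S₂-trace S~S₁ S~S₂
  with ∣p∣≡1⇒p≡⁅x⁆ (symDiff S S₁) S~S₁ | ∣p∣≡1⇒p≡⁅x⁆ (symDiff S S₂) S~S₂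
... | x₁ , S⊕S₁ | x₂ , S⊕S₂ = symDiff-cancelˡ S (begin
  symDiff S S₁      ≡⟨ S⊕S₁ ⟩
  ⁅ x₁ ⁆            ≡⟨ trace-flip X S-trace S₁-trace T₁≢T₂ S⊕S₁ ⟨
  symDiff T₁ T₂     ≡⟨ trace-flip X S-trace S₂-trace T₁≢T₂ S⊕S₂ ⟩
  ⁅ x₂ ⁆            ≡⟨ S⊕S₂ ⟨
  symDiff S S₂      ∎)
  where open ≡-Reasoning

edgeList : Graph n → Subset n → Subset n → Subset n → List (Subset n × Subset n)
edgeList G X T₁ T₂ =
  filter (λ p → GlauberAdj? (proj₁ p) (proj₂ p)) (cartesianProduct (classList G X T₁) (classList G X T₂))

module FlipEdges (G : Graph n) {Δ : ℕ} (maxDeg : MaxDegreeAtMost G Δ) (X T₁ T₂ : Subset n) {v : Fin n}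
  (T₁-ind : IsIndependent G T₁) (T₂-ind : IsIndependent G T₂)
  (T₁-trace : T₁ ∩ X ≡ T₁) (T₂-trace : T₂ ∩ X ≡ T₂) (T₁⊕T₂ : symDiff T₁ T₂ ≡ ⁅ v ⁆) where

  closedNbhd : List (Fin n)
  closedNbhd = v ∷ members (nbhd G v)

  closedNbhd-closed : ∀ {T} → (∀ {u} → adj G v u ≡ true → lookup T u ≡ false) →
    NeighbourClosed G closedNbhd T
  closedNbhd-closed avoids (here refl) _ vu = there (∈-members (nbhd G v) (trans (lookup-nbhd G v _) vu))
  closedNbhd-closed avoids (there w∈) Tw _ =
    ⊥-elim (not-¬ (avoids (trans (sym (lookup-nbhd G v _)) (∈-members⁻ (nbhd G v) w∈))) Tw)

  outside-agree : ∀ {u} → u ∉ closedNbhd → lookup T₁ u ≡ lookup T₂ u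
  outside-agree u∉ = sym (flipped-elsewhere T₁⊕T₂ (u∉ ∘ here))

  override-∈-class : ∀ {T S} → IsIndependent G T → T ∩ X ≡ T →
    (∀ {u} → u ∉ closedNbhd → lookup T₁ u ≡ lookup T u) → (∀ {u} → adj G v u ≡ true → lookup T u ≡ false) →
    S ∈ classList G X T₁ → override closedNbhd T S ∈ classList G X T
  override-∈-class {T} {S} T-ind T-trace T-outside avoids S∈ with ∈-classList⁻ G X T₁ S∈
  ... | S-ind , S-trace =
    ∈-classList⁺ G X T (IsIndependent⇒Independent G (override closedNbhd T S) R-ind) R-trace
    where
    R-ind : IsIndependent G (override closedNbhd T S)
    R-ind = override-isIndependent closedNbhd T S G T-ind (Independent⇒IsIndependent G S S-ind)
      (closedNbhd-closed {T} avoids)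
    R-trace : override closedNbhd T S ∩ X ≡ T
    R-trace = override-∩ closedNbhd T S X T-trace λ {u} u∉ →
      trans (cong (λ R → lookup R u) S-trace) (T-outside u∉)

  edge : Subset n → Subset n × Subset n
  edge S = override closedNbhd T₁ S , override closedNbhd T₂ S

  edge-∈ : ∀ {S} → S ∈ classList G X T₁ → edge S ∈ edgeList G X T₁ T₂
  edge-∈ {S} S∈ = ∈-filter⁺ _
    (∈-cartesianProduct⁺
      (override-∈-class T₁-ind T₁-trace (λ _ → refl) (flip-avoids-neighbours G T₁-ind T₂-ind T₁⊕T₂) S∈)
      (override-∈-class T₂-ind T₂-trace outside-agree
        (flip-avoids-neighbours G T₂-ind T₁-ind (trans (symDiff-comm T₂ T₁) T₁⊕T₂)) S∈))
    (subst (λ p → ∣ p ∣ ≡ 1) (sym (trans (symDiff-override closedNbhd S outside-agree) T₁⊕T₂))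
      (∣⁅x⁆∣≡1 v))

  classSize≤edges : classSize G X T₁ ≤ 2 ^ suc Δ * edgesBetween G X T₁ T₂
  classSize≤edges =
    ≤-trans (length≤-by-override closedNbhd T₁ edge (classList-unique G X T₁) edge-∈ (cong proj₁))
            (*-monoˡ-≤ (edgesBetween G X T₁ T₂) (^-monoʳ-≤ 2 (s≤s ∣N[v]∣≤Δ)))
    where
    ∣N[v]∣≤Δ : length (members (nbhd G v)) ≤ Δ
    ∣N[v]∣≤Δ = ≤-trans (≤-reflexive (length-members (nbhd G v))) (maxDeg v)

classSize≤edgesBetween : (G : Graph n) {Δ : ℕ} → MaxDegreeAtMost G Δ → (X T₁ T₂ : Subset n) →
  T₁ ≢ T₂ → 1 ≤ edgesBetween G X T₁ T₂ → classSize G X T₁ ≤ 2 ^ suc Δ * edgesBetween G X T₁ T₂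
classSize≤edgesBetween G maxDeg X T₁ T₂ T₁≢T₂ nonempty
  with nonempty⇒∈ {xs = edgeList G X T₁ T₂} nonempty
... | (S , S′) , e∈ with ∈-filter⁻ _ {xs = cartesianProduct (classList G X T₁) (classList G X T₂)} e∈
... | SS′∈ , S~S′ with ∈-cartesianProduct⁻ (classList G X T₁) (classList G X T₂) SS′∈
... | S∈ , S′∈
  with ∈-classList⁻ G X T₁ S∈ | ∈-classList⁻ G X T₂ S′∈ | ∣p∣≡1⇒p≡⁅x⁆ (symDiff S S′) S~S′
... | S-ind , S-trace | S′-ind , S′-trace | v , S⊕S′ =
  FlipEdges.classSize≤edges G maxDeg X T₁ T₂
    (trace-isIndependent G X S S-ind S-trace) (trace-isIndependent G X S′ S′-ind S′-trace)
    (trace-∩ G X S S-ind S-trace) (trace-∩ G X S′ S′-ind S′-trace)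
    (trace-flip X S-trace S′-trace T₁≢T₂ S⊕S′)

lemma4 : (t Δ : ℕ) → 1 ≤ t → 1 ≤ Δ →
    Σ ℕ λ c₁ → Σ ℕ λ d₂ → (1 ≤ c₁) × (1 ≤ d₂) ×
    (∀ (n : ℕ) (G : Graph n) (X : Subset n) →
      TreewidthAtMost G t → MaxDegreeAtMost G Δ →
      IsBalancedSeparator G X → ∣ X ∣ ≤ suc t →
      (numClasses G X ≤ 2 ^ suc t)
      × (∀ T₁ T₂ → 0 < classSize G X T₁ → 0 < classSize G X T₂ →
           classSize G X T₁ ≤ c₁ * classSize G X T₂)
      × (∀ T₁ T₂ → 0 < classSize G X T₁ → 0 < classSize G X T₂ → ¬ (T₁ ≡ T₂) →
           ∀ S S₁ S₂ → Independent G S → Independent G S₁ → Independent G S₂ →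
           S ∩ X ≡ T₁ → S₁ ∩ X ≡ T₂ → S₂ ∩ X ≡ T₂ →
           GlauberAdj S S₁ → GlauberAdj S S₂ → S₁ ≡ S₂)
      × (∀ T₁ T₂ → ¬ (T₁ ≡ T₂) → 1 ≤ edgesBetween G X T₁ T₂ →
           classSize G X T₁ ≤ d₂ * edgesBetween G X T₁ T₂))
lemma4 t Δ _ _ = 2 ^ (suc t + Δ * suc t) , 2 ^ suc Δ , m^n>0 2 (suc t + Δ * suc t) , m^n>0 2 (suc Δ) ,
  λ n G X _ maxDeg _ ∣X∣≤1+t →
    ≤-trans (numClasses≤2^∣X∣ G X) (^-monoʳ-≤ 2 ∣X∣≤1+t) ,
    (λ T₁ T₂ _ nonempty₂ →
      ≤-trans (classSize≤classSize G maxDeg X T₁ T₂ nonempty₂)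
              (*-monoˡ-≤ (classSize G X T₂) (^-monoʳ-≤ 2 (+-mono-≤ ∣X∣≤1+t (*-monoʳ-≤ Δ ∣X∣≤1+t))))) ,
    (λ T₁ T₂ _ _ T₁≢T₂ S S₁ S₂ _ _ _ → glauber-neighbour-unique X T₁≢T₂) ,
    (λ T₁ T₂ → classSize≤edgesBetween G maxDeg X T₁ T₂)
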